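{- For every $\phi\in\mathcal{L}$ and every individual variable $x$, if $\phi\in\mathsf{IntCK}$ then $Th\models_{fo}\forall x\,ST_x(\phi)$.
   Context: $\mathcal{L}$ is built from a countably infinite set $Var$ of propositional variables and $\top,\bot$ by $\wedge,\vee,\to$ and conditional connectives $\phi\mathbin{\Box\!\!\to}\psi$, $\phi\mathbin{\Diamond\!\!\to}\psi$. $\mathsf{IntCK}$ is the set of $\mathcal{L}$-formulas true at every world of every Chellas model $\mathcal{M}=(W,\leq,R,V)$ (with $W\neq\emptyset$, $\leq$ a preorder, $V$ assigning upward-closed sets to variables, $R\subseteq W\times\mathcal{P}(W)\times W$, $R_X(w,v)$ iff $(w,X,v)\in R$, satisfying for all $X$: (c1) $w\leq w'$ and $R_X(w,v)$ imply $R_X(w',v')$, $v\leq v'$ for some $v'$; (c2) $R_X(w,v)$ and $v\leq v'$ imply $w\leq w'$, $R_X(w',v')$ for some $w'$), where $\to$ is evaluated intuitionistically along $\leq$, $\psi\mathbin{\Box\!\!\to}\chi$ is true at $w$ iff $\chi$ holds at every $u$ with $R_{\|\psi\|}(v,u)$ for some $v\geq w$, and $\psi\mathbin{\Diamond\!\!\to}\chi$ is true at $w$ iff $\chi$ holds at some $u$ with $R_{\|\psi\|}(w,u)$ ($\|\psi\|$ = set of worlds where $\psi$ is true). First-order side: $\mathcal{L}_{fo}$ has atoms $px$ ($p\in Var$), $Rxyz$, $Ox$, $Sx$, $Exy$, $x\equiv y$, $\top,\bot$, connectives $\wedge,\vee,\to$, quantifiers; $(\forall x)_O\phi:=\forall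 x(Ox\to\phi)$. $\models_{fo}$ is intuitionistic first-order consequence, defined via Kripke sheaves: a preorder of worlds, classical structures at each world for this signature, and homomorphisms $\mathbb{H}_{wv}$ for $w\leq v$ (identity on $w\leq w$, composing along chains), with the usual intuitionistic forcing clauses ($\to$ and $\forall$ quantify over all later worlds, transporting the assignment along $\mathbb{H}$; $\equiv$ is identity); $\Sigma\models_{fo}\Pi$ iff no world and assignment force all of $\Sigma$ and none of $\Pi$. $Th$ consists of: $\forall x(Sx\vee Ox)$; $\forall x\neg(Sx\wedge Ox)$; $\forall x(px\to Ox)$ for $p\in Var$; $\forall x\forall y(Exy\to(Ox\wedge Sy))$; $\forall x\forall y\forall z(Rxyz\to(Ox\wedge Sy\wedge Oz))$; $\exists x(Sx\wedge\forall y(Eyx\leftrightarrow py))$ for $p\in Var$; $\exists x(Sx\wedge(\forall y)_O Eyx)$; $\exists x(Sx\wedge\forall y\neg Eyx)$; $\forall x\forall y((Sx\wedge Sy)\to\exists z(Sz\wedge(\forall w)_O(Ewz\leftrightarrow(Ewx\ast Ewy))))$ for $\ast\in\{\wedge,\vee,\to\}$; $\forall x\forall y((Sx\wedge Sy)\to\exists z(Sz\wedge(\forall w)_O(Ewz\leftrightarrow\forall u(Rwxu\to Euy))))$; $\forall x\forall y((Sx\wedge Sy)\to\exists z(Sz\wedge(\forall w)_O(Ewz\leftrightarrow\exists u(Rwxu\wedge Euy))))$; $\forall x\forall y((Sx\wedge Sy\wedge(\forall z)_O(Ezx\leftrightarrow Ezy))\to x\equiv y)$. Standard translation (with $x,y,z,w$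 pairwise distinct): $ST_x(p)=px$; $ST_x(\top)=\top$, $ST_x(\bot)=\bot$; $ST_x(\psi\ast\chi)=ST_x(\psi)\ast ST_x(\chi)$ for $\ast\in\{\wedge,\vee,\to\}$; $ST_x(\psi\mathbin{\Box\!\!\to}\chi)=\exists y(Sy\wedge(\forall z)_O(Ezy\leftrightarrow ST_z(\psi))\wedge\forall w(Rxyw\to ST_w(\chi)))$; $ST_x(\psi\mathbin{\Diamond\!\!\to}\chi)=\exists y(Sy\wedge(\forall z)_O(Ezy\leftrightarrow ST_z(\psi))\wedge\exists w(Rxyw\wedge ST_w(\chi)))$. -}

module Defs where

open import Data.Nat using (ℕ; suc; _+_; _≡ᵇ_)
open import Data.Bool using (if_then_else_)
open import Data.Product using (Σ; _×_; _,_)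
open import Data.Sum using (_⊎_)
open import Data.Unit using (⊤)
open import Data.Empty using (⊥)
open import Relation.Binary.PropositionalEquality using (_≡_)

infixr 6 _∧_
infixr 5 _∨_
infixr 4 _⇒_ _□→_ _◇→_

data Form : Set where
  var   : ℕ → Form
  ⊤'    : Form
  ⊥'    : Form
  _∧_   : Form → Form → Form
  _∨_   : Form → Form → Form
  _⇒_   : Form → Form → Form
  _□→_  : Form → Form → Form
  _◇→_  : Form → Form → Form

-- Chellas models.  Subsets of W are predicates W → Set; since in the
-- paper R is indexed by *sets* X ⊆ W, R is required to be extensional
-- in X (field R-ext).

record ChellasModel : Set₁ where
  field
    W        : Set
    inhabited : W
    _≤_      : W → W → Set
    ≤-refl   : ∀ {w} → w ≤ w
    ≤-trans  : ∀ {u v w} → u ≤ v → v ≤ w → u ≤ w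
    V        : ℕ → W → Set
    V-mono   : ∀ p {w w'} → w ≤ w' → V p w → V p w'
    R        : (W → Set) → W → W → Set
    R-ext    : ∀ (X Y : W → Set) → (∀ u → (X u → Y u) × (Y u → X u))
               → ∀ w v → R X w v → R Y w v
    c1       : ∀ (X : W → Set) w w' v → w ≤ w' → R X w v
               → Σ W (λ v' → R X w' v' × (v ≤ v'))
    c2       : ∀ (X : W → Set) w v v' → R X w v → v ≤ v'
               → Σ W (λ w' → (w ≤ w') × R X w' v')

module _ (M : ChellasModel) where
  open ChellasModel M

  _⊨_ : W → Form → Set
  w ⊨ var p    = V p w
  w ⊨ ⊤'       = ⊤
  w ⊨ ⊥'       = ⊥
  w ⊨ (φ ∧ ψ)  = (w ⊨ φ) × (w ⊨ ψ)
  w ⊨ (φ ∨ ψ)  = (w ⊨ φ) ⊎ (w ⊨ ψ)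
  w ⊨ (φ ⇒ ψ)  = ∀ v → w ≤ v → v ⊨ φ → v ⊨ ψ
  w ⊨ (φ □→ ψ) = ∀ u → (Σ W (λ v → (w ≤ v) × R (λ t → t ⊨ φ) v u)) → u ⊨ ψ
  w ⊨ (φ ◇→ ψ) = Σ W (λ u → R (λ t → t ⊨ φ) w u × (u ⊨ ψ))

IntCK : Form → Set₁
IntCK φ = ∀ (M : ChellasModel) (w : ChellasModel.W M) → _⊨_ M w φ

infixr 6 _∧ᶠ_
infixr 5 _∨ᶠ_
infixr 4 _⇒ᶠ_

data FoForm : Set where
  P    : ℕ → ℕ → FoForm
  Rᶠ   : ℕ → ℕ → ℕ → FoForm
  Oᶠ   : ℕ → FoForm
  Sᶠ   : ℕ → FoForm
  Eᶠ   : ℕ → ℕ → FoForm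
  _≐_  : ℕ → ℕ → FoForm
  ⊤ᶠ   : FoForm
  ⊥ᶠ   : FoForm
  _∧ᶠ_ : FoForm → FoForm → FoForm
  _∨ᶠ_ : FoForm → FoForm → FoForm
  _⇒ᶠ_ : FoForm → FoForm → FoForm
  ∀ᶠ   : ℕ → FoForm → FoForm
  ∃ᶠ   : ℕ → FoForm → FoForm

¬ᶠ_ : FoForm → FoForm
¬ᶠ φ = φ ⇒ᶠ ⊥ᶠ

_⇔ᶠ_ : FoForm → FoForm → FoForm
φ ⇔ᶠ ψ = (φ ⇒ᶠ ψ) ∧ᶠ (ψ ⇒ᶠ φ)

∀O : ℕ → FoForm → FoForm
∀O x φ = ∀ᶠ x (Oᶠ x ⇒ᶠ φ)

-- Kripke sheaves.  The transition maps take the (irrelevant) proof of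
-- w ≤ v, so there is exactly one map 𝓗_wv per pair w ≤ v.

record KripkeSheaf : Set₁ where
  field
    W       : Set
    _≤_     : W → W → Set
    ≤-refl  : ∀ {w} → w ≤ w
    ≤-trans : ∀ {u v w} → u ≤ v → v ≤ w → u ≤ w
    D       : W → Set
    H       : ∀ {w v} → .(w ≤ v) → D w → D v
    H-id    : ∀ {w} (d : D w) → H (≤-refl {w}) d ≡ d
    H-comp  : ∀ {u v w} (p : u ≤ v) (q : v ≤ w) (d : D u)
              → H (≤-trans p q) d ≡ H q (H p d)
    Pr      : ℕ → (w : W) → D w → Set
    Rr      : (w : W) → D w → D w → D w → Set
    Or      : (w : W) → D w → Set
    Sr      : (w : W) → D w → Set
    Er      : (w : W) → D w → D w → Set
    Pr-mono : ∀ p {w v} (h : w ≤ v) {d} → Pr p w d → Pr p v (H h d)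
    Rr-mono : ∀ {w v} (h : w ≤ v) {d e f} → Rr w d e f
              → Rr v (H h d) (H h e) (H h f)
    Or-mono : ∀ {w v} (h : w ≤ v) {d} → Or w d → Or v (H h d)
    Sr-mono : ∀ {w v} (h : w ≤ v) {d} → Sr w d → Sr v (H h d)
    Er-mono : ∀ {w v} (h : w ≤ v) {d e} → Er w d e → Er v (H h d) (H h e)

module _ (K : KripkeSheaf) where
  open KripkeSheaf K

  upd : ∀ {A : Set} → (ℕ → A) → ℕ → A → ℕ → A
  upd a x d y = if y ≡ᵇ x then d else a y

  _,_⊩_ : (w : W) → (ℕ → D w) → FoForm → Set
  w , a ⊩ P p x      = Pr p w (a x)
  w , a ⊩ Rᶠ x y z   = Rr w (a x) (a y) (a z)
  w , a ⊩ Oᶠ x       = Or w (a x)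
  w , a ⊩ Sᶠ x       = Sr w (a x)
  w , a ⊩ Eᶠ x y     = Er w (a x) (a y)
  w , a ⊩ (x ≐ y)    = a x ≡ a y
  w , a ⊩ ⊤ᶠ         = ⊤
  w , a ⊩ ⊥ᶠ         = ⊥
  w , a ⊩ (φ ∧ᶠ ψ)   = (w , a ⊩ φ) × (w , a ⊩ ψ)
  w , a ⊩ (φ ∨ᶠ ψ)   = (w , a ⊩ φ) ⊎ (w , a ⊩ ψ)
  w , a ⊩ (φ ⇒ᶠ ψ)   = ∀ v (h : w ≤ v) → v , (λ y → H h (a y)) ⊩ φ
                                          → v , (λ y → H h (a y)) ⊩ ψ
  w , a ⊩ ∀ᶠ x φ     = ∀ v (h : w ≤ v) (d : D v) → v , upd (λ y → H h (a y)) x d ⊩ φ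
  w , a ⊩ ∃ᶠ x φ     = Σ (D w) (λ d → w , upd a x d ⊩ φ)

-- The theory Th  (fixed distinct variable names x=0,y=1,z=2,w=3,u=4)

data InTh : FoForm → Set where
  th-SO    : InTh (∀ᶠ 0 (Sᶠ 0 ∨ᶠ Oᶠ 0))
  th-nSO   : InTh (∀ᶠ 0 (¬ᶠ (Sᶠ 0 ∧ᶠ Oᶠ 0)))
  th-pO    : ∀ p → InTh (∀ᶠ 0 (P p 0 ⇒ᶠ Oᶠ 0))
  th-E     : InTh (∀ᶠ 0 (∀ᶠ 1 (Eᶠ 0 1 ⇒ᶠ (Oᶠ 0 ∧ᶠ Sᶠ 1))))
  th-R     : InTh (∀ᶠ 0 (∀ᶠ 1 (∀ᶠ 2 (Rᶠ 0 1 2 ⇒ᶠ (Oᶠ 0 ∧ᶠ Sᶠ 1 ∧ᶠ Oᶠ 2)))))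
  th-var   : ∀ p → InTh (∃ᶠ 0 (Sᶠ 0 ∧ᶠ ∀ᶠ 1 (Eᶠ 1 0 ⇔ᶠ P p 1)))
  th-top   : InTh (∃ᶠ 0 (Sᶠ 0 ∧ᶠ ∀O 1 (Eᶠ 1 0)))
  th-bot   : InTh (∃ᶠ 0 (Sᶠ 0 ∧ᶠ ∀ᶠ 1 (¬ᶠ (Eᶠ 1 0))))
  th-and   : InTh (∀ᶠ 0 (∀ᶠ 1 ((Sᶠ 0 ∧ᶠ Sᶠ 1) ⇒ᶠ
               ∃ᶠ 2 (Sᶠ 2 ∧ᶠ ∀O 3 (Eᶠ 3 2 ⇔ᶠ (Eᶠ 3 0 ∧ᶠ Eᶠ 3 1))))))
  th-or    : InTh (∀ᶠ 0 (∀ᶠ 1 ((Sᶠ 0 ∧ᶠ Sᶠ 1) ⇒ᶠ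
               ∃ᶠ 2 (Sᶠ 2 ∧ᶠ ∀O 3 (Eᶠ 3 2 ⇔ᶠ (Eᶠ 3 0 ∨ᶠ Eᶠ 3 1))))))
  th-imp   : InTh (∀ᶠ 0 (∀ᶠ 1 ((Sᶠ 0 ∧ᶠ Sᶠ 1) ⇒ᶠ
               ∃ᶠ 2 (Sᶠ 2 ∧ᶠ ∀O 3 (Eᶠ 3 2 ⇔ᶠ (Eᶠ 3 0 ⇒ᶠ Eᶠ 3 1))))))
  th-box   : InTh (∀ᶠ 0 (∀ᶠ 1 ((Sᶠ 0 ∧ᶠ Sᶠ 1) ⇒ᶠ
               ∃ᶠ 2 (Sᶠ 2 ∧ᶠ ∀O 3 (Eᶠ 3 2 ⇔ᶠ ∀ᶠ 4 (Rᶠ 3 0 4 ⇒ᶠ Eᶠ 4 1))))))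
  th-dia   : InTh (∀ᶠ 0 (∀ᶠ 1 ((Sᶠ 0 ∧ᶠ Sᶠ 1) ⇒ᶠ
               ∃ᶠ 2 (Sᶠ 2 ∧ᶠ ∀O 3 (Eᶠ 3 2 ⇔ᶠ ∃ᶠ 4 (Rᶠ 3 0 4 ∧ᶠ Eᶠ 4 1))))))
  th-ext   : InTh (∀ᶠ 0 (∀ᶠ 1 ((Sᶠ 0 ∧ᶠ Sᶠ 1 ∧ᶠ ∀O 2 (Eᶠ 2 0 ⇔ᶠ Eᶠ 2 1)) ⇒ᶠ (0 ≐ 1))))

Th⊨fo : FoForm → Set₁
Th⊨fo φ = ∀ (K : KripkeSheaf) (w : KripkeSheaf.W K) (a : ℕ → KripkeSheaf.D K w)
          → (∀ ψ → InTh ψ → _,_⊩_ K w a ψ) → _,_⊩_ K w a φ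

-- Standard translation.  In ST_x the bound variables y, z, w are taken
-- to be x+1, x+2, x+3 (pairwise distinct and distinct from x);
-- ST_x(φ) has x as its only free variable.

ST : ℕ → Form → FoForm
ST x (var p)   = P p x
ST x ⊤'        = ⊤ᶠ
ST x ⊥'        = ⊥ᶠ
ST x (φ ∧ ψ)   = ST x φ ∧ᶠ ST x ψ
ST x (φ ∨ ψ)   = ST x φ ∨ᶠ ST x ψ
ST x (φ ⇒ ψ)   = ST x φ ⇒ᶠ ST x ψ
ST x (φ □→ ψ)  = ∃ᶠ y (Sᶠ y ∧ᶠ ∀O z (Eᶠ z y ⇔ᶠ ST z φ) ∧ᶠ ∀ᶠ w (Rᶠ x y w ⇒ᶠ ST w ψ))
  where y = x + 1 ; z = x + 2 ; w = x + 3
ST x (φ ◇→ ψ)  = ∃ᶠ y (Sᶠ y ∧ᶠ ∀O z (Eᶠ z y ⇔ᶠ ST z φ) ∧ᶠ ∃ᶠ w (Rᶠ x y w ∧ᶠ ST w ψ))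
  where y = x + 1 ; z = x + 2 ; w = x + 3

{-# OPTIONS --safe #-}
-- A Kripke sheaf with a world w₀ forcing Th under a₀ is turned into a Chellas model whose
-- worlds are the elements d ∈ D v of the worlds v ≥ w₀, ordered along the transition maps,
-- with each variable p true where the predicate p holds. The comprehension axioms of Th make
-- the extension of every formula representable: some S-element s satisfies, at every later
-- world and for every O-element o there, E o s iff o lies in the extension; the
-- extensionality axiom makes s unique. Letting R_X relate d to e when R d s e for a
-- representative s of X, induction on φ shows that φ holds at the point d iff ST_x φ is
-- forced at d. Hence a formula valid in all Chellas models has ∀x ST_x φ forced at w₀.
module Submission where

open import Defs
open import Data.Bool using (true; false)
open import Data.Empty using (⊥-elim)
open import Data.Nat using (ℕ; _+_; _≡ᵇ_)
open import Data.Nat.Properties using (≡ᵇ⇒≡; ≡⇒≡ᵇ; +-cancelˡ-≡; m+1+n≢m)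
open import Data.Product using (Σ; _×_; _,_; proj₁; proj₂)
open import Data.Product.Function.Dependent.Propositional using (Σ-⇔)
open import Data.Product.Function.NonDependent.Propositional using (_×-⇔_)
open import Data.Sum using (inj₁; inj₂)
open import Data.Sum.Function.Propositional using (_⊎-⇔_)
open import Data.Unit using (tt)
open import Function using (_∘_; id)
open import Function.Bundles using (_⇔_; mk⇔; Equivalence)
open import Function.Construct.Identity using (↠-id)
open import Function.Properties.Equivalence
  using () renaming (refl to ⇔-refl; trans to ⇔-trans; sym to ⇔-sym)
open import Function.Related.Propositional using (≡⇒; equivalence)
open import Level using (0ℓ)
open import Relation.Binary.PropositionalEquality
  using (_≡_; _≢_; _≗_; refl; sym; trans; cong; cong₂; subst; subst₂)
open import Relation.Unary using (Pred; _∩_; _∪_)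

open Equivalence using (to; from)

≡⇒⇔ : ∀ {A B : Set} → A ≡ B → A ⇔ B
≡⇒⇔ = ≡⇒ {k = equivalence}

+-congˡ-≢ : ∀ x {i j} → i ≢ j → x + i ≢ x + j
+-congˡ-≢ x {i} {j} i≢j = i≢j ∘ +-cancelˡ-≡ x i j

module Forcing (K : KripkeSheaf) where
  open KripkeSheaf K

  infix 2 _∣_⊩_
  _∣_⊩_ : (w : W) → (ℕ → D w) → FoForm → Set
  w ∣ a ⊩ φ = _,_⊩_ K w a φ

  infixr 7 _⇑_
  _⇑_ : ∀ {w v} → w ≤ v → (ℕ → D w) → ℕ → D v
  (h ⇑ a) y = H h (a y)

  infixl 6 _[_↦_]
  _[_↦_] : ∀ {A : Set} → (ℕ → A) → ℕ → A → ℕ → A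
  a [ x ↦ d ] = upd K a x d

  [↦]-same : ∀ {A : Set} (a : ℕ → A) x d → (a [ x ↦ d ]) x ≡ d
  [↦]-same a x d with x ≡ᵇ x | ≡⇒≡ᵇ x x refl
  ... | true | _ = refl

  [↦]-other : ∀ {A : Set} (a : ℕ → A) {x y} d → y ≢ x → (a [ x ↦ d ]) y ≡ a y
  [↦]-other a {x} {y} d y≢x with y ≡ᵇ x | ≡ᵇ⇒≡ y x
  ... | true  | y≡x = ⊥-elim (y≢x (y≡x _))
  ... | false | _   = refl

  [↦]-cong : ∀ {A : Set} {a b : ℕ → A} x d → a ≗ b → a [ x ↦ d ] ≗ b [ x ↦ d ]
  [↦]-cong x d a≗b y with y ≡ᵇ x
  ... | true  = refl
  ... | false = a≗b y

  ⇑-[↦] : ∀ {w v} (h : w ≤ v) (a : ℕ → D w) x d → h ⇑ (a [ x ↦ d ]) ≗ h ⇑ a [ x ↦ H h d ]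
  ⇑-[↦] h a x d y with y ≡ᵇ x
  ... | true  = refl
  ... | false = refl

  ⇑-refl : ∀ {w} (a : ℕ → D w) → ≤-refl ⇑ a ≗ a
  ⇑-refl a y = H-id (a y)

  ⇑-trans : ∀ {u v w} (h : u ≤ v) (h' : v ≤ w) (a : ℕ → D u) → h' ⇑ h ⇑ a ≗ ≤-trans h h' ⇑ a
  ⇑-trans h h' a y = sym (H-comp h h' (a y))

  Rr-resp : ∀ {v d d' s s' e e'} → d ≡ d' → s ≡ s' → e ≡ e' → Rr v d s e → Rr v d' s' e'
  Rr-resp refl refl refl r = r

  ⊩-cong : ∀ φ {w} {a b : ℕ → D w} → a ≗ b → w ∣ a ⊩ φ → w ∣ b ⊩ φ
  ⊩-cong (P p x)    a≗b = subst (Pr p _) (a≗b x)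
  ⊩-cong (Rᶠ x y z) a≗b = Rr-resp (a≗b x) (a≗b y) (a≗b z)
  ⊩-cong (Oᶠ x)     a≗b = subst (Or _) (a≗b x)
  ⊩-cong (Sᶠ x)     a≗b = subst (Sr _) (a≗b x)
  ⊩-cong (Eᶠ x y)   a≗b = subst₂ (Er _) (a≗b x) (a≗b y)
  ⊩-cong (x ≐ y)    a≗b a≡ = trans (sym (a≗b x)) (trans a≡ (a≗b y))
  ⊩-cong ⊤ᶠ         a≗b t = t
  ⊩-cong ⊥ᶠ         a≗b ()
  ⊩-cong (φ ∧ᶠ ψ)   a≗b (f , g) = ⊩-cong φ a≗b f , ⊩-cong ψ a≗b g
  ⊩-cong (φ ∨ᶠ ψ)   a≗b (inj₁ f) = inj₁ (⊩-cong φ a≗b f)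
  ⊩-cong (φ ∨ᶠ ψ)   a≗b (inj₂ g) = inj₂ (⊩-cong ψ a≗b g)
  ⊩-cong (φ ⇒ᶠ ψ)   a≗b f v h =
    ⊩-cong ψ (cong (H h) ∘ a≗b) ∘ f v h ∘ ⊩-cong φ (sym ∘ cong (H h) ∘ a≗b)
  ⊩-cong (∀ᶠ x φ)   a≗b f v h d = ⊩-cong φ ([↦]-cong x d (cong (H h) ∘ a≗b)) (f v h d)
  ⊩-cong (∃ᶠ x φ)   a≗b (d , f) = d , ⊩-cong φ ([↦]-cong x d a≗b) f

  ⇒ᶠ-elim : ∀ φ ψ {w} (a : ℕ → D w) → w ∣ a ⊩ φ ⇒ᶠ ψ → w ∣ a ⊩ φ → w ∣ a ⊩ ψ
  ⇒ᶠ-elim φ ψ a f =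
    ⊩-cong ψ (⇑-refl a) ∘ f _ ≤-refl ∘ ⊩-cong φ (sym ∘ ⇑-refl a)

  ⇔ᶠ-elim : ∀ φ ψ {w} (a : ℕ → D w) → w ∣ a ⊩ φ ⇔ᶠ ψ → (w ∣ a ⊩ φ) ⇔ (w ∣ a ⊩ ψ)
  ⇔ᶠ-elim φ ψ a (f , g) = mk⇔ (⇒ᶠ-elim φ ψ a f) (⇒ᶠ-elim ψ φ a g)

  ∀ᶠ-elim : ∀ x φ {w} (a : ℕ → D w) → w ∣ a ⊩ ∀ᶠ x φ → ∀ d → w ∣ a [ x ↦ d ] ⊩ φ
  ∀ᶠ-elim x φ a f d = ⊩-cong φ ([↦]-cong x d (⇑-refl a)) (f _ ≤-refl d)

  ⇑-[↦]-trans : ∀ {u v w} (h : u ≤ v) (h' : v ≤ w) (a : ℕ → D u) x d →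
                h' ⇑ (h ⇑ a [ x ↦ d ]) ≗ ≤-trans h h' ⇑ a [ x ↦ H h' d ]
  ⇑-[↦]-trans h h' a x d y =
    trans (⇑-[↦] h' (h ⇑ a) x d y) ([↦]-cong x (H h' d) (⇑-trans h h' a) y)

  ∀⇒ᶠ-⇔ : ∀ x φ ψ {w} (a : ℕ → D w) →
          (w ∣ a ⊩ ∀ᶠ x (φ ⇒ᶠ ψ)) ⇔
          (∀ {v} (h : w ≤ v) d → v ∣ h ⇑ a [ x ↦ d ] ⊩ φ → v ∣ h ⇑ a [ x ↦ d ] ⊩ ψ)
  ∀⇒ᶠ-⇔ x φ ψ a = mk⇔
    (λ f {v} h d → ⇒ᶠ-elim φ ψ _ (f v h d))
    (λ g v h d v' h' → ⊩-cong ψ (sym ∘ ⇑-[↦]-trans h h' a x d)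
                       ∘ g (≤-trans h h') (H h' d)
                       ∘ ⊩-cong φ (⇑-[↦]-trans h h' a x d))

  ∀O-⇔ : ∀ x φ {w} (a : ℕ → D w) →
         (w ∣ a ⊩ ∀O x φ) ⇔ (∀ {v} (h : w ≤ v) {o} → Or v o → v ∣ h ⇑ a [ x ↦ o ] ⊩ φ)
  ∀O-⇔ x φ a = mk⇔
    (λ f {v} h {o} O → to (∀⇒ᶠ-⇔ x (Oᶠ x) φ a) f h o (subst (Or _) (sym ([↦]-same (h ⇑ a) x o)) O))
    (λ g → from (∀⇒ᶠ-⇔ x (Oᶠ x) φ a) λ {v} h o O → g h (subst (Or _) ([↦]-same (h ⇑ a) x o) O))

  ∀O⇔ᶠ-⇔ : ∀ x φ ψ {w} (a : ℕ → D w) →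
           (w ∣ a ⊩ ∀O x (φ ⇔ᶠ ψ)) ⇔
           (∀ {v} (h : w ≤ v) {o} → Or v o → (v ∣ h ⇑ a [ x ↦ o ] ⊩ φ) ⇔ (v ∣ h ⇑ a [ x ↦ o ] ⊩ ψ))
  ∀O⇔ᶠ-⇔ x φ ψ {w} a = mk⇔
    (λ f {v} h {o} O → ⇔ᶠ-elim φ ψ _ (to (∀O-⇔ x (φ ⇔ᶠ ψ) a) f h O))
    (from (∀O-⇔ x (φ ⇔ᶠ ψ) a) ∘ intro)
    where
    intro : (∀ {v} (h : w ≤ v) {o} → Or v o → (v ∣ h ⇑ a [ x ↦ o ] ⊩ φ) ⇔ (v ∣ h ⇑ a [ x ↦ o ] ⊩ ψ)) →
            ∀ {v} (h : w ≤ v) {o} → Or v o → v ∣ h ⇑ a [ x ↦ o ] ⊩ φ ⇔ᶠ ψ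
    intro g {v} h {o} O =
        (λ v' h' → ⊩-cong ψ (sym ∘ shift h') ∘ to (later h') ∘ ⊩-cong φ (shift h'))
      , (λ v' h' → ⊩-cong φ (sym ∘ shift h') ∘ from (later h') ∘ ⊩-cong ψ (shift h'))
      where
      shift : ∀ {v'} (h' : v ≤ v') → h' ⇑ (h ⇑ a [ x ↦ o ]) ≗ ≤-trans h h' ⇑ a [ x ↦ H h' o ]
      shift h' = ⇑-[↦]-trans h h' a x o
      later : ∀ {v'} (h' : v ≤ v') →
              (v' ∣ ≤-trans h h' ⇑ a [ x ↦ H h' o ] ⊩ φ) ⇔ (v' ∣ ≤-trans h h' ⇑ a [ x ↦ H h' o ] ⊩ ψ)
      later h' = g (≤-trans h h') (Or-mono h' O)

module Canonical (K : KripkeSheaf) (w₀ : KripkeSheaf.W K) (a₀ : ℕ → KripkeSheaf.D K w₀)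
                 (th : ∀ {ψ} → InTh ψ → _,_⊩_ K w₀ a₀ ψ) where
  open KripkeSheaf K
  open Forcing K

  record Point : Set where
    constructor pt
    field
      world : W
      above : w₀ ≤ world
      elem  : D world
  open Point

  _⊑_ : Point → Point → Set
  u ⊑ u' = Σ (world u ≤ world u') λ h → H h (elem u) ≡ elem u'

  ⊑-refl : ∀ {u} → u ⊑ u
  ⊑-refl = ≤-refl , H-id _

  ⊑-trans : ∀ {u₁ u₂ u₃} → u₁ ⊑ u₂ → u₂ ⊑ u₃ → u₁ ⊑ u₃
  ⊑-trans (h₁ , e₁) (h₂ , e₂) =
    ≤-trans h₁ h₂ , trans (H-comp h₁ h₂ _) (trans (cong (H h₂) e₁) e₂)

  -- Only O-elements are tested: every R-successor is one (R-target-O).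
  Represents : Pred Point 0ℓ → (v : W) → D v → Set
  Represents X v s =
    ∀ {v'} (q : w₀ ≤ v') (h : v ≤ v') {o} → Or v' o → Er v' o (H h s) ⇔ X (pt v' q o)

  Representable : Pred Point 0ℓ → W → Set
  Representable X v = Σ (D v) λ s → Sr v s × Represents X v s

  represents-mono : ∀ {X v v' s} → Represents X v s → (h : v ≤ v') → Represents X v' (H h s)
  represents-mono {s = s} r h q h' O =
    ⇔-trans (≡⇒⇔ (cong (Er _ _) (sym (H-comp h h' s)))) (r q (≤-trans h h') O)

  representable-mono : ∀ {X v v'} → Representable X v → v ≤ v' → Representable X v'
  representable-mono (s , S , r) h = H h s , Sr-mono h S , represents-mono r h

  data Rᶜ (X : Pred Point 0ℓ) : Point → Point → Set where
    via : ∀ {v p d e} s → Sr v s → Represents X v s → Rr v d s e → Rᶜ X (pt v p d) (pt v p e)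

  Rᶜ-resp : ∀ (X Y : Pred Point 0ℓ) → (∀ u → (X u → Y u) × (Y u → X u)) →
            ∀ u t → Rᶜ X u t → Rᶜ Y u t
  Rᶜ-resp X Y X≐Y _ _ (via s S r rr) =
    via s S (λ q h O → ⇔-trans (r q h O) (mk⇔ (proj₁ (X≐Y _)) (proj₂ (X≐Y _)))) rr

  Rᶜ-c1 : ∀ X u u' t → u ⊑ u' → Rᶜ X u t → Σ Point λ t' → Rᶜ X u' t' × t ⊑ t'
  Rᶜ-c1 X _ (pt v' q _) _ (h , refl) (via {e = e} s S r rr) =
    pt v' q (H h e) , via (H h s) (Sr-mono h S) (represents-mono r h) (Rr-mono h rr) , (h , refl)

  Rᶜ-c2 : ∀ X u t t' → Rᶜ X u t → t ⊑ t' → Σ Point λ u' → u ⊑ u' × Rᶜ X u' t'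
  Rᶜ-c2 X _ _ (pt v' q _) (via {d = d} s S r rr) (h , refl) =
    pt v' q (H h d) , (h , refl) , via (H h s) (Sr-mono h S) (represents-mono r h) (Rr-mono h rr)

  canonical : ChellasModel
  canonical = record
    { W         = Point
    ; inhabited = pt w₀ ≤-refl (a₀ 0)
    ; _≤_       = _⊑_
    ; ≤-refl    = λ {u} → ⊑-refl {u}
    ; ≤-trans   = λ {u₁} {u₂} {u₃} → ⊑-trans {u₁} {u₂} {u₃}
    ; V         = λ n u → Pr n (world u) (elem u)
    ; V-mono    = λ n {u} {u'} (h , e) → subst (Pr n (world u')) e ∘ Pr-mono n h
    ; R         = Rᶜ
    ; R-ext     = Rᶜ-resp
    ; c1        = Rᶜ-c1
    ; c2        = Rᶜ-c2
    }

  ⟦_⟧ : Form → Pred Point 0ℓ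
  ⟦ φ ⟧ u = _⊨_ canonical u φ

  _⇛_ : Pred Point 0ℓ → Pred Point 0ℓ → Pred Point 0ℓ
  (X ⇛ Y) u = ∀ u' → u ⊑ u' → X u' → Y u'

  □⟨_⟩_ : Pred Point 0ℓ → Pred Point 0ℓ → Pred Point 0ℓ
  (□⟨ X ⟩ Y) u = ∀ t → Σ Point (λ u' → u ⊑ u' × Rᶜ X u' t) → Y t

  ◇⟨_⟩_ : Pred Point 0ℓ → Pred Point 0ℓ → Pred Point 0ℓ
  (◇⟨ X ⟩ Y) u = Σ Point λ t → Rᶜ X u t × Y t

  instantiate₂ : ∀ {φ v} → InTh (∀ᶠ 0 (∀ᶠ 1 φ)) → (p : w₀ ≤ v) (d₀ d₁ : D v) →
                 v ∣ p ⇑ a₀ [ 0 ↦ d₀ ] [ 1 ↦ d₁ ] ⊩ φ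
  instantiate₂ {φ} {v} ax p d₀ = ∀ᶠ-elim 1 φ (p ⇑ a₀ [ 0 ↦ d₀ ]) (th ax v p d₀)

  R-target-O : ∀ {v d s e} → w₀ ≤ v → Rr v d s e → Or v e
  R-target-O {d = d} {s} {e} p = proj₂ ∘ proj₂ ∘ ⇒ᶠ-elim (Rᶠ 0 1 2) typing (ρ [ 2 ↦ e ])
    (∀ᶠ-elim 2 (Rᶠ 0 1 2 ⇒ᶠ typing) ρ (instantiate₂ th-R p d s) e)
    where
    typing = Oᶠ 0 ∧ᶠ Sᶠ 1 ∧ᶠ Oᶠ 2
    ρ = p ⇑ a₀ [ 0 ↦ d ] [ 1 ↦ s ]

  extensionality : ∀ {v s₁ s₂} → w₀ ≤ v → Sr v s₁ → Sr v s₂ →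
                   (∀ {v'} (h : v ≤ v') {o} → Or v' o → Er v' o (H h s₁) ⇔ Er v' o (H h s₂)) →
                   s₁ ≡ s₂
  extensionality {s₁ = s₁} {s₂} p S₁ S₂ same =
    ⇒ᶠ-elim (Sᶠ 0 ∧ᶠ Sᶠ 1 ∧ᶠ ∀O 2 coextensive) (0 ≐ 1) ρ (instantiate₂ th-ext p s₁ s₂)
      (S₁ , S₂ , from (∀O⇔ᶠ-⇔ 2 (Eᶠ 2 0) (Eᶠ 2 1) ρ) same)
    where
    coextensive = Eᶠ 2 0 ⇔ᶠ Eᶠ 2 1
    ρ = p ⇑ a₀ [ 0 ↦ s₁ ] [ 1 ↦ s₂ ]

  represents-unique : ∀ {X v s₁ s₂} → w₀ ≤ v → Sr v s₁ → Sr v s₂ →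
                      Represents X v s₁ → Represents X v s₂ → s₁ ≡ s₂
  represents-unique p S₁ S₂ r₁ r₂ = extensionality p S₁ S₂ λ h O →
    ⇔-trans (r₁ (≤-trans p h) h O) (⇔-sym (r₂ (≤-trans p h) h O))

  Comprehension : FoForm → FoForm
  Comprehension χ = ∀ᶠ 0 (∀ᶠ 1 ((Sᶠ 0 ∧ᶠ Sᶠ 1) ⇒ᶠ ∃ᶠ 2 (Sᶠ 2 ∧ᶠ ∀O 3 (Eᶠ 3 2 ⇔ᶠ χ))))

  representable-by-comprehension :
    ∀ {χ} {Z : Pred Point 0ℓ} {v s₁ s₂} → InTh (Comprehension χ) →
    (p : w₀ ≤ v) → Sr v s₁ → Sr v s₂ →
    (∀ s {v'} (q : w₀ ≤ v') (h : v ≤ v') {o} → Or v' o →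
       (v' ∣ h ⇑ (p ⇑ a₀ [ 0 ↦ s₁ ] [ 1 ↦ s₂ ] [ 2 ↦ s ]) [ 3 ↦ o ] ⊩ χ) ⇔ Z (pt v' q o)) →
    Representable Z v
  representable-by-comprehension {χ} {s₁ = s₁} {s₂} ax p S₁ S₂ reads =
    let s , S , defines = ⇒ᶠ-elim (Sᶠ 0 ∧ᶠ Sᶠ 1) (∃ᶠ 2 (Sᶠ 2 ∧ᶠ ∀O 3 (Eᶠ 3 2 ⇔ᶠ χ))) ρ
                                  (instantiate₂ ax p s₁ s₂) (S₁ , S₂)
    in s , S , λ q h O → ⇔-trans (to (∀O⇔ᶠ-⇔ 3 (Eᶠ 3 2) χ (ρ [ 2 ↦ s ])) defines h O)
                                 (reads s q h O)
    where ρ = p ⇑ a₀ [ 0 ↦ s₁ ] [ 1 ↦ s₂ ]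

  var-representable : ∀ n → Representable ⟦ var n ⟧ w₀
  var-representable n =
    let s , S , defines = th (th-var n) in
    s , S , λ q h {o} _ → ⇔ᶠ-elim (Eᶠ 1 0) (P n 1) (h ⇑ (a₀ [ 0 ↦ s ]) [ 1 ↦ o ]) (defines _ h o)

  ⊤-representable : Representable ⟦ ⊤' ⟧ w₀
  ⊤-representable =
    let s , S , all = th th-top in
    s , S , λ q h O → mk⇔ (λ _ → tt) (λ _ → to (∀O-⇔ 1 (Eᶠ 1 0) (a₀ [ 0 ↦ s ])) all h O)

  ⊥-representable : Representable ⟦ ⊥' ⟧ w₀
  ⊥-representable =
    let s , S , none = th th-bot in
    s , S , λ q h {o} _ →
      mk⇔ (⇒ᶠ-elim (Eᶠ 1 0) ⊥ᶠ (h ⇑ (a₀ [ 0 ↦ s ]) [ 1 ↦ o ]) (none _ h o)) λ ()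

  ∩-representable : ∀ {X Y v} → w₀ ≤ v → Representable X v → Representable Y v →
                    Representable (X ∩ Y) v
  ∩-representable p (_ , S₁ , r₁) (_ , S₂ , r₂) =
    representable-by-comprehension th-and p S₁ S₂ λ _ q h O → r₁ q h O ×-⇔ r₂ q h O

  ∪-representable : ∀ {X Y v} → w₀ ≤ v → Representable X v → Representable Y v →
                    Representable (X ∪ Y) v
  ∪-representable p (_ , S₁ , r₁) (_ , S₂ , r₂) =
    representable-by-comprehension th-or p S₁ S₂ λ _ q h O → r₁ q h O ⊎-⇔ r₂ q h O

  ⇛-at : ∀ {X Y v p d} → (X ⇛ Y) (pt v p d) ⇔
         (∀ v' (q : w₀ ≤ v') (h : v ≤ v') → X (pt v' q (H h d)) → Y (pt v' q (H h d)))
  ⇛-at = mk⇔ (λ f v' q h → f _ (h , refl)) λ { g (pt v' q _) (h , refl) → g v' q h }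

  ⇛-via : ∀ {X Y v s₁ s₂ o} → Represents X v s₁ → Represents Y v s₂ → (q : w₀ ≤ v) → Or v o →
          (∀ v' (h : v ≤ v') → Er v' (H h o) (H h s₁) → Er v' (H h o) (H h s₂)) ⇔ (X ⇛ Y) (pt v q o)
  ⇛-via {X} {Y} r₁ r₂ q O = ⇔-trans (mk⇔
    (λ f v' q' h → to (r₂ q' h (Or-mono h O)) ∘ f v' h ∘ from (r₁ q' h (Or-mono h O)))
    (λ g v' h → from (r₂ (≤-trans q h) h (Or-mono h O)) ∘ g v' (≤-trans q h) h
                ∘ to (r₁ (≤-trans q h) h (Or-mono h O))))
    (⇔-sym (⇛-at {X} {Y} {p = q}))

  ⇛-representable : ∀ {X Y v} → w₀ ≤ v → Representable X v → Representable Y v →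
                    Representable (X ⇛ Y) v
  ⇛-representable p (_ , S₁ , r₁) (_ , S₂ , r₂) =
    representable-by-comprehension th-imp p S₁ S₂ λ _ q h O →
      ⇛-via (represents-mono r₁ h) (represents-mono r₂ h) q O

  □-along : ∀ {v} → D v → D v → Pred Point 0ℓ → Set
  □-along {v} s d Y = ∀ {v'} (q : w₀ ≤ v') (h : v ≤ v') {e} → Rr v' (H h d) (H h s) e → Y (pt v' q e)

  □-via : ∀ {X Y v p d s} → Sr v s → Represents X v s → (□⟨ X ⟩ Y) (pt v p d) ⇔ □-along s d Y
  □-via {X} {Y} {v} {p} {d} {s} S r = mk⇔ out into
    where
    out : (□⟨ X ⟩ Y) (pt v p d) → □-along s d Y
    out box q h rr =
      box _ (pt _ q (H h d) , (h , refl) , via (H h s) (Sr-mono h S) (represents-mono r h) rr)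
    into : □-along s d Y → (□⟨ X ⟩ Y) (pt v p d)
    into along _ (pt _ q _ , (h , refl) , via s' S' r' rr) =
      along q h (Rr-resp refl (represents-unique q S' (Sr-mono h S) r' (represents-mono r h)) refl rr)

  □-along⇔members : ∀ {Y v s d t} → w₀ ≤ v → Represents Y v t →
                 (∀ {v'} (h : v ≤ v') e → Rr v' (H h d) (H h s) e → Er v' e (H h t)) ⇔ □-along s d Y
  □-along⇔members p r = mk⇔
    (λ f {v'} q h {e} rr → to (r q h (R-target-O q rr)) (f h e rr))
    (λ g {v'} h e rr → let q = ≤-trans p h in from (r q h (R-target-O q rr)) (g q h rr))

  □-representable : ∀ {X Y v} → w₀ ≤ v → Representable X v → Representable Y v →
                    Representable (□⟨ X ⟩ Y) v
  □-representable {X} {Y} p (s₁ , S₁ , r₁) (s₂ , S₂ , r₂) =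
    representable-by-comprehension th-box p S₁ S₂ λ s q h {o} O →
      ⇔-trans (∀⇒ᶠ-⇔ 4 (Rᶠ 3 0 4) (Eᶠ 4 1) (h ⇑ (p ⇑ a₀ [ 0 ↦ s₁ ] [ 1 ↦ s₂ ] [ 2 ↦ s ]) [ 3 ↦ o ]))
        (⇔-trans (□-along⇔members q (represents-mono r₂ h))
                 (⇔-sym (□-via {X} {Y} {p = q} (Sr-mono h S₁) (represents-mono r₁ h))))

  ◇-via : ∀ {X Y v p d s} → Sr v s → Represents X v s →
          (◇⟨ X ⟩ Y) (pt v p d) ⇔ (Σ (D v) λ e → Rr v d s e × Y (pt v p e))
  ◇-via {p = p} S r = mk⇔
    (λ { (_ , via s' S' r' rr , y) → _ , Rr-resp refl (represents-unique p S' S r' r) refl rr , y })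
    (λ (e , rr , y) → pt _ p e , via _ S r rr , y)

  ◇-representable : ∀ {X Y v} → w₀ ≤ v → Representable X v → Representable Y v →
                    Representable (◇⟨ X ⟩ Y) v
  ◇-representable {X} {Y} p (_ , S₁ , r₁) (_ , S₂ , r₂) =
    representable-by-comprehension th-dia p S₁ S₂ λ _ q h O →
      ⇔-trans (mk⇔ (λ (e , rr , m) → e , rr , to (r₂ q h (R-target-O q rr)) m)
                   (λ (e , rr , y) → e , rr , from (r₂ q h (R-target-O q rr)) y))
              (⇔-sym (◇-via {X} {Y} (Sr-mono h S₁) (represents-mono r₁ h)))

  represent : ∀ φ {v} → w₀ ≤ v → Representable ⟦ φ ⟧ v
  represent (var n)  p = representable-mono (var-representable n) p
  represent ⊤'       p = representable-mono ⊤-representable p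
  represent ⊥'       p = representable-mono ⊥-representable p
  represent (φ ∧ ψ)  p = ∩-representable p (represent φ p) (represent ψ p)
  represent (φ ∨ ψ)  p = ∪-representable p (represent φ p) (represent ψ p)
  represent (φ ⇒ ψ)  p = ⇛-representable p (represent φ p) (represent ψ p)
  represent (φ □→ ψ) p = □-representable p (represent φ p) (represent ψ p)
  represent (φ ◇→ ψ) p = ◇-representable p (represent φ p) (represent ψ p)

  ⇔-via-representative : ∀ {X v} {A : Set} {B : D v → Set} → Representable X v →
    (∀ {s} → Sr v s → Represents X v s → A ⇔ B s) → A ⇔ (Σ (D v) λ s → Sr v s × Represents X v s × B s)
  ⇔-via-representative {X} {v} {A} {B} (s , S , r) A⇔B = mk⇔ pick forget
    where
    pick : A → Σ (D v) λ s → Sr v s × Represents X v s × B s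
    pick a = s , S , r , to (A⇔B S r) a
    forget : (Σ (D v) λ s → Sr v s × Represents X v s × B s) → A
    forget (_ , S' , r' , b) = from (A⇔B S' r') b

  TruthLemma : Form → Set
  TruthLemma φ =
    ∀ x {v} (p : w₀ ≤ v) (a : ℕ → D v) {d} → a x ≡ d → ⟦ φ ⟧ (pt v p d) ⇔ (v ∣ a ⊩ ST x φ)

  defines⇔represents : ∀ φ → TruthLemma φ → ∀ x {v} (p : w₀ ≤ v) (a : ℕ → D v) s →
    (v ∣ a [ x + 1 ↦ s ] ⊩ ∀O (x + 2) (Eᶠ (x + 2) (x + 1) ⇔ᶠ ST (x + 2) φ)) ⇔ Represents ⟦ φ ⟧ v s
  defines⇔represents φ truth-φ x {v} p a s =
    ⇔-trans (∀O⇔ᶠ-⇔ (x + 2) (Eᶠ (x + 2) (x + 1)) (ST (x + 2) φ) (a [ x + 1 ↦ s ])) (mk⇔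
      (λ f {v'} q h {o} O →
        ⇔-trans (member h o) (⇔-trans (f h O) (⇔-sym (truth-φ _ q _ (bz h o)))))
      (λ r {v'} h {o} O → ⇔-trans (⇔-sym (member h o))
                            (⇔-trans (r (≤-trans p h) h O) (truth-φ _ (≤-trans p h) _ (bz h o)))))
    where
    b : ∀ {v'} → v ≤ v' → D v' → ℕ → D v'
    b h o = h ⇑ (a [ x + 1 ↦ s ]) [ x + 2 ↦ o ]
    bz : ∀ {v'} (h : v ≤ v') o → b h o (x + 2) ≡ o
    bz h o = [↦]-same (h ⇑ (a [ x + 1 ↦ s ])) (x + 2) o
    by : ∀ {v'} (h : v ≤ v') o → b h o (x + 1) ≡ H h s
    by h o = trans ([↦]-other (h ⇑ (a [ x + 1 ↦ s ])) o (+-congˡ-≢ x λ ()))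
                   (cong (H h) ([↦]-same a (x + 1) s))
    member : ∀ {v'} (h : v ≤ v') o → Er v' o (H h s) ⇔ Er v' (b h o (x + 2)) (b h o (x + 1))
    member h o = ≡⇒⇔ (sym (cong₂ (Er _) (bz h o) (by h o)))

  ST-vars : ∀ {A B : Set} (f : A → B) (a : ℕ → A) x s e →
            let c = (f ∘ (a [ x + 1 ↦ s ])) [ x + 3 ↦ e ] in
            c x ≡ f (a x) × c (x + 1) ≡ f s × c (x + 3) ≡ e
  ST-vars f a x s e =
      trans ([↦]-other c e (m+1+n≢m x {2} ∘ sym)) (cong f ([↦]-other a s (m+1+n≢m x {0} ∘ sym)))
    , trans ([↦]-other c e (+-congˡ-≢ x λ ())) (cong f ([↦]-same a (x + 1) s))
    , [↦]-same c (x + 3) e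
    where c = f ∘ (a [ x + 1 ↦ s ])

  ST-□ : ∀ φ ψ → TruthLemma φ → TruthLemma ψ → ∀ x {v} (p : w₀ ≤ v) (a : ℕ → D v) →
         (v ∣ a ⊩ ST x (φ □→ ψ)) ⇔
         (Σ (D v) λ s → Sr v s × Represents ⟦ φ ⟧ v s × □-along s (a x) ⟦ ψ ⟧)
  ST-□ φ ψ truth-φ truth-ψ x {v} p a = Σ-⇔ (↠-id _) λ {s} →
    ≡⇒⇔ (cong (Sr v) ([↦]-same a (x + 1) s)) ×-⇔ defines⇔represents φ truth-φ x p a s ×-⇔ box s
    where
    box : ∀ s → (v ∣ a [ x + 1 ↦ s ] ⊩ ∀ᶠ (x + 3) (Rᶠ x (x + 1) (x + 3) ⇒ᶠ ST (x + 3) ψ)) ⇔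
                □-along s (a x) ⟦ ψ ⟧
    box s = ⇔-trans (∀⇒ᶠ-⇔ (x + 3) (Rᶠ x (x + 1) (x + 3)) (ST (x + 3) ψ) (a [ x + 1 ↦ s ])) (mk⇔
      (λ f {v'} q h {e} rr → let cx , cy , ce = ST-vars (H h) a x s e in
        from (truth-ψ (x + 3) q _ ce) (f h e (Rr-resp (sym cx) (sym cy) (sym ce) rr)))
      (λ g {v'} h e rr → let cx , cy , ce = ST-vars (H h) a x s e in
        to (truth-ψ (x + 3) (≤-trans p h) _ ce) (g (≤-trans p h) h (Rr-resp cx cy ce rr))))

  ST-◇ : ∀ φ ψ → TruthLemma φ → TruthLemma ψ → ∀ x {v} (p : w₀ ≤ v) (a : ℕ → D v) →
         (v ∣ a ⊩ ST x (φ ◇→ ψ)) ⇔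
         (Σ (D v) λ s → Sr v s × Represents ⟦ φ ⟧ v s × Σ (D v) λ e → Rr v (a x) s e × ⟦ ψ ⟧ (pt v p e))
  ST-◇ φ ψ truth-φ truth-ψ x {v} p a = Σ-⇔ (↠-id _) λ {s} →
    ≡⇒⇔ (cong (Sr v) ([↦]-same a (x + 1) s)) ×-⇔ defines⇔represents φ truth-φ x p a s ×-⇔
    Σ-⇔ (↠-id _) λ {e} → let cx , cy , ce = ST-vars id a x s e in
      mk⇔ (Rr-resp cx cy ce) (Rr-resp (sym cx) (sym cy) (sym ce))
      ×-⇔ ⇔-sym (truth-ψ (x + 3) p _ ce)

  truth-lemma : ∀ φ → TruthLemma φ
  truth-lemma (var n)  x p a refl = ⇔-refl
  truth-lemma ⊤'       x p a refl = ⇔-refl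
  truth-lemma ⊥'       x p a refl = ⇔-refl
  truth-lemma (φ ∧ ψ)  x p a refl = truth-lemma φ x p a refl ×-⇔ truth-lemma ψ x p a refl
  truth-lemma (φ ∨ ψ)  x p a refl = truth-lemma φ x p a refl ⊎-⇔ truth-lemma ψ x p a refl
  truth-lemma (φ ⇒ ψ)  x p a refl = ⇔-trans (⇛-at {⟦ φ ⟧} {⟦ ψ ⟧} {p = p}) (mk⇔
    (λ f v' h → let q = ≤-trans p h in
      to (truth-lemma ψ x q (h ⇑ a) refl) ∘ f v' q h ∘ from (truth-lemma φ x q (h ⇑ a) refl))
    (λ F v' q h →
      from (truth-lemma ψ x q (h ⇑ a) refl) ∘ F v' h ∘ to (truth-lemma φ x q (h ⇑ a) refl)))
  truth-lemma (φ □→ ψ) x p a refl =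
    ⇔-trans (⇔-via-representative (represent φ p) (□-via {⟦ φ ⟧} {⟦ ψ ⟧} {p = p}))
            (⇔-sym (ST-□ φ ψ (truth-lemma φ) (truth-lemma ψ) x p a))
  truth-lemma (φ ◇→ ψ) x p a refl =
    ⇔-trans (⇔-via-representative (represent φ p) (◇-via {⟦ φ ⟧} {⟦ ψ ⟧}))
            (⇔-sym (ST-◇ φ ψ (truth-lemma φ) (truth-lemma ψ) x p a))

proposition5 : (φ : Form) (x : ℕ) → IntCK φ → Th⊨fo (∀ᶠ x (ST x φ))
proposition5 φ x valid K w₀ a₀ th v p d =
  to (truth-lemma φ x p (p ⇑ a₀ [ x ↦ d ]) ([↦]-same (p ⇑ a₀) x d)) (valid canonical (pt v p d))
  where
  open Forcing K
  open Canonical K w₀ a₀ (th _)
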